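{- Let $K$ be a field, $G\le K^\times$ a multiplicative subgroup with $G\neq K^\times$ and $-1\in G$, $T:=G+1$, and $\mathcal{N}_G:=\{\bigcap_{i=1}^n a_i\cdot T: n\in\mathbb{N}, a_1,\dots,a_n\in K^\times\}$. With $U,V$ ranging over $\mathcal{N}_G$, the following are equivalent: (V3) for all $U$ there exists $V$ with $V-V\subseteq U$; (V3)$'$ there exists $V$ with $V-V\subseteq T$; (V3)$^*$ for all $U$ there exists $V$ with $V+V\subseteq U$.
   Context: $G+1=\{g+1:g\in G\}$, $a\cdot X=\{ax:x\in X\}$, $V-V=\{x-y:x,y\in V\}$, $V+V=\{x+y:x,y\in V\}$. -}

module Defs where

open import Level using (Level; _⊔_; suc)
open import Algebra.Bundles using (CommutativeRing)
open import Data.Nat using (ℕ)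
open import Data.Fin using (Fin)
open import Data.Product using (Σ; ∃; _×_; _,_)
open import Relation.Nullary using (¬_)

record Field (c ℓ : Level) : Set (suc (c ⊔ ℓ)) where
  field
    commutativeRing : CommutativeRing c ℓ
  open CommutativeRing commutativeRing public
  field
    0≉1     : ¬ (0# ≈ 1#)
    inverse : ∀ x → ¬ (x ≈ 0#) → ∃ λ y → x * y ≈ 1#

module _ {c ℓ : Level} (K : Field c ℓ) where
  open Field K

  Unit : Carrier → Set ℓ
  Unit x = ¬ (x ≈ 0#)

  record IsUnitSubgroup {g : Level} (G : Carrier → Set g) : Set (c ⊔ ℓ ⊔ g) where
    field
      resp    : ∀ {x y} → x ≈ y → G x → G y
      ⊆units  : ∀ {x} → G x → Unit x
      one     : G 1#
      mul     : ∀ {x y} → G x → G y → G (x * y)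
      inv     : ∀ {x y} → G x → x * y ≈ 1# → G y

  module _ {g : Level} (G : Carrier → Set g) where

    T : Carrier → Set (c ⊔ ℓ ⊔ g)
    T t = ∃ λ h → G h × (t ≈ h + 1#)

    _·_ : ∀ {p} → Carrier → (Carrier → Set p) → Carrier → Set (c ⊔ ℓ ⊔ p)
    (a · X) z = ∃ λ x → X x × (z ≈ a * x)

    -- The member ⋂_{i=1}^n a_i · T of 𝒩_G determined by n and a_1,…,a_n.
    -- (Its membership in 𝒩_G additionally requires each a_i ∈ K^×.)
    Nset : (n : ℕ) → (Fin n → Carrier) → Carrier → Set (c ⊔ ℓ ⊔ g)
    Nset n a z = ∀ i → (a i · T) z

    Adm : (n : ℕ) → (Fin n → Carrier) → Set ℓ
    Adm n a = ∀ i → Unit (a i)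

    _-_⊆_ : ∀ {p q} → (Carrier → Set p) → (Carrier → Set p) → (Carrier → Set q) → Set (c ⊔ p ⊔ q)
    (V - V' ⊆ X) = ∀ x y → V x → V' y → X (x + (- y))

    _+_⊆_ : ∀ {p q} → (Carrier → Set p) → (Carrier → Set p) → (Carrier → Set q) → Set (c ⊔ p ⊔ q)
    (V + V' ⊆ X) = ∀ x y → V x → V' y → X (x + y)

    V3 : Set (c ⊔ ℓ ⊔ g)
    V3 = ∀ n a → Adm n a →
           Σ ℕ λ m → Σ (Fin m → Carrier) λ b → Adm m b ×
             (Nset m b - Nset m b ⊆ Nset n a)

    V3′ : Set (c ⊔ ℓ ⊔ g)
    V3′ = Σ ℕ λ m → Σ (Fin m → Carrier) λ b → Adm m b ×
             (Nset m b - Nset m b ⊆ T)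

    V3* : Set (c ⊔ ℓ ⊔ g)
    V3* = ∀ n a → Adm n a →
           Σ ℕ λ m → Σ (Fin m → Carrier) λ b → Adm m b ×
             (Nset m b + Nset m b ⊆ Nset n a)

-- Every member of 𝒩_G stays in 𝒩_G under scaling by a unit, finite
-- intersection and negation, since a·(⋂ bᵢ·T) = ⋂ (a bᵢ)·T and
-- -(⋂ bᵢ·T) = ⋂ (-bᵢ)·T.  Hence "∃ V, V - V ⊆ U" passes from U = T to every
-- U = ⋂ aᵢ·T by scaling and intersecting, and V ∩ (-V) turns a V with
-- V - V ⊆ U into one with V + V ⊆ U and back.
module Submission where

open import Defs
open import Level using (Level; _⊔_)
open import Data.Product using (Σ; ∃; _×_; _,_)
open import Relation.Nullary using (¬_)
open import Function.Base using (_∘_)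
open import Function.Bundles using (_⇔_; mk⇔)
open import Data.Nat using (ℕ; zero; suc) renaming (_+_ to _+ℕ_)
open import Data.Fin using (Fin; zero; suc; splitAt; _↑ˡ_; _↑ʳ_)
open import Data.Sum using (inj₁; inj₂)
open import Data.Vec.Functional using (_++_)
open import Data.Vec.Functional.Properties using (lookup-++ˡ; lookup-++ʳ)
open import Relation.Binary.PropositionalEquality using (subst)
open import Relation.Binary.Definitions using (_Respects_)

module UnitProperties {c ℓ : Level} (K : Field c ℓ) where
  open Field K
  open import Algebra.Properties.Ring ring using (-‿involutive; -0#≈0#)
  open import Relation.Binary.Reasoning.Setoid setoid

  1-unit : Unit K 1#
  1-unit 1≈0 = 0≉1 (sym 1≈0)

  *-unit : ∀ {a b} → Unit K a → Unit K b → Unit K (a * b)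
  *-unit {a} {b} a≉0 b≉0 ab≈0 with inverse a a≉0
  ... | a⁻¹ , aa⁻¹≈1 = b≉0 (begin
    b              ≈⟨ *-identityˡ b ⟨
    1# * b         ≈⟨ *-congʳ (trans (*-comm a⁻¹ a) aa⁻¹≈1) ⟨
    (a⁻¹ * a) * b  ≈⟨ *-assoc a⁻¹ a b ⟩
    a⁻¹ * (a * b)  ≈⟨ *-congˡ ab≈0 ⟩
    a⁻¹ * 0#       ≈⟨ zeroʳ a⁻¹ ⟩
    0#             ∎)

  -‿unit : ∀ {b} → Unit K b → Unit K (- b)
  -‿unit {b} b≉0 -b≈0 = b≉0 (begin
    b        ≈⟨ -‿involutive b ⟨
    - (- b)  ≈⟨ -‿cong -b≈0 ⟩
    - 0#     ≈⟨ -0#≈0# ⟩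
    0#       ∎)

module _ {c ℓ g : Level} (K : Field c ℓ) (G : Field.Carrier K → Set g) where
  open Field K hiding (zero)
  open UnitProperties K
  open import Algebra.Properties.Ring ring using (-‿involutive; -‿distribˡ-*; -‿distribʳ-*)
  open import Relation.Binary.Reasoning.Setoid setoid

  ∃V-V⊆_ : ∀ {q} → (Carrier → Set q) → Set (c ⊔ ℓ ⊔ g ⊔ q)
  ∃V-V⊆ X = Σ ℕ λ m → Σ (Fin m → Carrier) λ b → Adm K G m b ×
              (_-_⊆_ K G (Nset K G m b) (Nset K G m b) X)

  ∃V+V⊆_ : ∀ {q} → (Carrier → Set q) → Set (c ⊔ ℓ ⊔ g ⊔ q)
  ∃V+V⊆ X = Σ ℕ λ m → Σ (Fin m → Carrier) λ b → Adm K G m b ×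
              (_+_⊆_ K G (Nset K G m b) (Nset K G m b) X)

  Adm-++ : ∀ {m k b b′} → Adm K G m b → Adm K G k b′ → Adm K G (m +ℕ k) (b ++ b′)
  Adm-++ {m} adm adm′ i with splitAt m i
  ... | inj₁ j = adm j
  ... | inj₂ j = adm′ j

  Nset-++⁻ˡ : ∀ {m k b b′ z} → Nset K G (m +ℕ k) (b ++ b′) z → Nset K G m b z
  Nset-++⁻ˡ {k = k} {b} {b′} {z} z∈V i =
    subst (λ s → _·_ K G s (T K G) z) (lookup-++ˡ b b′ i) (z∈V (i ↑ˡ k))

  Nset-++⁻ʳ : ∀ {m k b b′ z} → Nset K G (m +ℕ k) (b ++ b′) z → Nset K G k b′ z
  Nset-++⁻ʳ {m} {b = b} {b′} {z} z∈V i =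
    subst (λ s → _·_ K G s (T K G) z) (lookup-++ʳ b b′ i) (z∈V (m ↑ʳ i))

  Nset-resp : ∀ {n a} → Nset K G n a Respects _≈_
  Nset-resp z≈z′ z∈U i with z∈U i
  ... | t , t∈T , z≈aᵢt = t , t∈T , trans (sym z≈z′) z≈aᵢt

  Nset-zero : ∀ {b z} → Nset K G 0 b z
  Nset-zero ()

  Nset-suc : ∀ {n a z} → _·_ K G (a zero) (T K G) z × Nset K G n (a ∘ suc) z →
             Nset K G (suc n) a z
  Nset-suc (z∈a₀T , _)   zero    = z∈a₀T
  Nset-suc (_     , z∈U) (suc i) = z∈U i

  Nset-*ˡ⁻ : ∀ {m b a z} → Unit K a → Nset K G m (λ j → a * b j) z →
             _·_ K G a (Nset K G m b) z
  Nset-*ˡ⁻ {m} {b} {a} {z} a≉0 z∈aV with inverse a a≉0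
  ... | a⁻¹ , aa⁻¹≈1 = a⁻¹ * z , a⁻¹z∈V , sym (begin
      a * (a⁻¹ * z)  ≈⟨ *-assoc a a⁻¹ z ⟨
      (a * a⁻¹) * z  ≈⟨ *-congʳ aa⁻¹≈1 ⟩
      1# * z         ≈⟨ *-identityˡ z ⟩
      z              ∎)
    where
    a⁻¹z∈V : Nset K G m b (a⁻¹ * z)
    a⁻¹z∈V j with z∈aV j
    ... | t , t∈T , z≈abⱼt = t , t∈T , (begin
      a⁻¹ * z              ≈⟨ *-congˡ (trans z≈abⱼt (*-assoc a (b j) t)) ⟩
      a⁻¹ * (a * (b j * t)) ≈⟨ *-assoc a⁻¹ a _ ⟨
      (a⁻¹ * a) * (b j * t) ≈⟨ *-congʳ (trans (*-comm a⁻¹ a) aa⁻¹≈1) ⟩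
      1# * (b j * t)        ≈⟨ *-identityˡ _ ⟩
      b j * t               ∎)

  Nset-neg⁻ : ∀ {m b z} → Nset K G m (-_ ∘ b) z → Nset K G m b (- z)
  Nset-neg⁻ {m} {b} {z} z∈-V j with z∈-V j
  ... | t , t∈T , z≈-bⱼt = t , t∈T , (begin
      - z            ≈⟨ -‿cong z≈-bⱼt ⟩
      - (- b j * t)  ≈⟨ -‿cong (-‿distribˡ-* (b j) t) ⟨
      - (- (b j * t)) ≈⟨ -‿involutive _ ⟩
      b j * t        ∎)

  ∃V-V⊆-mono : ∀ {p q} {X : Carrier → Set p} {Y : Carrier → Set q} →
               (∀ {z} → X z → Y z) → ∃V-V⊆ X → ∃V-V⊆ Y
  ∃V-V⊆-mono X⊆Y (m , b , adm , V-V⊆X) =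
    m , b , adm , λ x y x∈V y∈V → X⊆Y (V-V⊆X x y x∈V y∈V)

  ∃V-V⊆-∩ : ∀ {p q} {X : Carrier → Set p} {Y : Carrier → Set q} →
            ∃V-V⊆ X → ∃V-V⊆ Y → ∃V-V⊆ (λ z → X z × Y z)
  ∃V-V⊆-∩ (m , b , adm , V-V⊆X) (k , b′ , adm′ , W-W⊆Y) =
    m +ℕ k , b ++ b′ , Adm-++ adm adm′ , λ x y x∈V∩W y∈V∩W →
      V-V⊆X x y (Nset-++⁻ˡ x∈V∩W) (Nset-++⁻ˡ y∈V∩W) ,
      W-W⊆Y x y (Nset-++⁻ʳ x∈V∩W) (Nset-++⁻ʳ y∈V∩W)

  ∃V-V⊆-· : ∀ {p a} {X : Carrier → Set p} → Unit K a → ∃V-V⊆ X → ∃V-V⊆ (_·_ K G a X)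
  ∃V-V⊆-· {a = a} {X} a≉0 (m , b , adm , V-V⊆X) =
    m , (λ j → a * b j) , (λ j → *-unit a≉0 (adm j)) , aV-aV⊆aX
    where
    aV-aV⊆aX : _-_⊆_ K G (Nset K G m (λ j → a * b j)) (Nset K G m (λ j → a * b j)) (_·_ K G a X)
    aV-aV⊆aX x y x∈aV y∈aV with Nset-*ˡ⁻ a≉0 x∈aV | Nset-*ˡ⁻ a≉0 y∈aV
    ... | x′ , x′∈V , x≈ax′ | y′ , y′∈V , y≈ay′ = x′ + - y′ , V-V⊆X x′ y′ x′∈V y′∈V , (begin
      x + - y               ≈⟨ +-cong x≈ax′ (-‿cong y≈ay′) ⟩
      a * x′ + - (a * y′)   ≈⟨ +-congˡ (-‿distribʳ-* a y′) ⟩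
      a * x′ + a * (- y′)   ≈⟨ distribˡ a x′ (- y′) ⟨
      a * (x′ + - y′)       ∎)

  V3′⇒V3 : V3′ K G → V3 K G
  V3′⇒V3 _     zero    _ _   = 0 , (λ ()) , (λ ()) , λ _ _ _ _ → Nset-zero
  V3′⇒V3 V-V⊆T (suc n) a adm =
    ∃V-V⊆-mono (λ {z} → Nset-suc {n} {a} {z})
      (∃V-V⊆-∩ {X = _·_ K G (a zero) (T K G)} {Y = Nset K G n (a ∘ suc)}
               (∃V-V⊆-· (adm zero) V-V⊆T)
               (V3′⇒V3 V-V⊆T n (a ∘ suc) (adm ∘ suc)))

  Nset-1⊆T : ∀ {z} → Nset K G 1 (λ _ → 1#) z → T K G z
  Nset-1⊆T z∈1T with z∈1T zero
  ... | t , (h , h∈G , t≈h+1) , z≈1t = h , h∈G , trans z≈1t (trans (*-identityˡ t) t≈h+1)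

  V3⇒V3′ : V3 K G → V3′ K G
  V3⇒V3′ v3 = ∃V-V⊆-mono {X = Nset K G 1 (λ _ → 1#)} Nset-1⊆T (v3 1 (λ _ → 1#) (λ _ → 1-unit))

  symmetrise : ∀ {m} → (Fin m → Carrier) → Fin (m +ℕ m) → Carrier
  symmetrise b = b ++ (-_ ∘ b)

  Adm-symmetrise : ∀ {m b} → Adm K G m b → Adm K G (m +ℕ m) (symmetrise b)
  Adm-symmetrise adm = Adm-++ adm (-‿unit ∘ adm)

  ∃V-V⊆⇒∃V+V⊆ : ∀ {q} {X : Carrier → Set q} → X Respects _≈_ → ∃V-V⊆ X → ∃V+V⊆ X
  ∃V-V⊆⇒∃V+V⊆ X-resp (m , b , adm , V-V⊆X) =
    m +ℕ m , symmetrise b , Adm-symmetrise adm , λ x y x∈W y∈W →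
      X-resp (+-congˡ (-‿involutive y))
        (V-V⊆X x (- y) (Nset-++⁻ˡ x∈W) (Nset-neg⁻ (Nset-++⁻ʳ y∈W)))

  ∃V+V⊆⇒∃V-V⊆ : ∀ {q} {X : Carrier → Set q} → ∃V+V⊆ X → ∃V-V⊆ X
  ∃V+V⊆⇒∃V-V⊆ (m , b , adm , V+V⊆X) =
    m +ℕ m , symmetrise b , Adm-symmetrise adm , λ x y x∈W y∈W →
      V+V⊆X x (- y) (Nset-++⁻ˡ x∈W) (Nset-neg⁻ (Nset-++⁻ʳ y∈W))

  V3⇔V3* : V3 K G ⇔ V3* K G
  V3⇔V3* = mk⇔
    (λ v3 n a adm → ∃V-V⊆⇒∃V+V⊆ Nset-resp (v3 n a adm))
    (λ v3* n a adm → ∃V+V⊆⇒∃V-V⊆ {X = Nset K G n a} (v3* n a adm))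

-- Only the description of 𝒩_G is used: the equivalences hold for every
-- predicate G.
lemma4p3 : {c ℓ g : Level} (K : Field c ℓ) (G : Field.Carrier K → Set g) →
    IsUnitSubgroup K G →
    (∃ λ x → Unit K x × ¬ G x) →
    G (Field.-_ K (Field.1# K)) →
    (V3 K G ⇔ V3′ K G) × (V3 K G ⇔ V3* K G)
lemma4p3 K G _ _ _ = mk⇔ (V3⇒V3′ K G) (V3′⇒V3 K G) , V3⇔V3* K G
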